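{- Let $T$ be a finite tree rooted at $r$. Consider the recursive procedure $\mathrm{Assign}(u,t)$ (for a node $u$ and an integer $t$) which does the following: (1) set $a(u), \overline{a}(u), b(u), \overline{b}(u)$ all equal to $t$; (2) for each child $v$ of $u$, in some order, call $\mathrm{Assign}(v, \overline{b}(u)+1)$ (using the current value of $\overline{b}(u)$) and then set $\overline{a}(u) \gets \overline{a}(v)$ and $\overline{b}(u) \gets \overline{b}(v)$; (3) after all children are processed, set $b(u)$ to some integer with $b(u) \ge \overline{a}(u)$ (current value); (4) set $\overline{b}(u) \gets \max\{b(u), \overline{b}(u)\}$. The order of the children in step (2) and the choice of $b(u)$ in step (3) are arbitrary subject to $b(u)\ge \overline{a}(u)$. Then after running $\mathrm{Assign}(r,0)$, for every node $u$ of $T$, \[ \overline{a}(u) = \max_{v \in T_u} a(v), \qquad \overline{b}(u) = \max_{v \in T_u} b(v), \] where $T_u$ is the set of descendants of $u$ (including $u$).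
   Context: In a rooted tree, $v$ is a descendant of $u$ if $u$ lies on the unique path from the root to $v$; every node is a descendant of itself. -}

module Defs where

open import Data.Integer using (ℤ; _+_; _≤_; _⊔_; +_)
open import Data.List using (List; []; _∷_)
open import Data.List.Membership.Propositional using (_∈_)
open import Data.Product using (_×_; ∃-syntax)
open import Relation.Binary.PropositionalEquality using (_≡_)

-- The children order is the (arbitrary) order used in step (2) of Assign;
-- quantifying over all such trees covers every possible order.
data Tree : Set where
  node : List Tree → Tree

data ATree : Set where
  anode : (a a̅ b b̅ : ℤ) → List ATree → ATree

aOf a̅Of bOf b̅Of : ATree → ℤ
aOf (anode a _ _ _ _) = a
a̅Of (anode _ a̅ _ _ _) = a̅
bOf (anode _ _ b _ _) = b
b̅Of (anode _ _ _ b̅ _) = b̅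

children : ATree → List ATree
children (anode _ _ _ _ cs) = cs

-- Possible runs of the nondeterministic procedure Assign.
-- AssignKids cs a̅ b̅ rs a̅' b̅' : processing children cs (step 2) starting
-- from current values a̅(u)=a̅, b̅(u)=b̅ yields annotated children rs and
-- final current values a̅(u)=a̅', b̅(u)=b̅'.
data Assign : Tree → ℤ → ATree → Set
data AssignKids : List Tree → ℤ → ℤ → List ATree → ℤ → ℤ → Set

data Assign where
  assign : ∀ {cs t rs a̅' b̅'} (b : ℤ) →
           AssignKids cs t t rs a̅' b̅' →
           a̅' ≤ b →
           Assign (node cs) t (anode t a̅' b (b ⊔ b̅') rs)

data AssignKids where
  kids-nil  : ∀ {a̅ b̅} → AssignKids [] a̅ b̅ [] a̅ b̅
  kids-cons : ∀ {c cs a̅ b̅ r rs a̅' b̅'} →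
              Assign c (b̅ + + 1) r →
              AssignKids cs (a̅Of r) (b̅Of r) rs a̅' b̅' →
              AssignKids (c ∷ cs) a̅ b̅ (r ∷ rs) a̅' b̅'

data Desc : ATree → ATree → Set where
  here  : ∀ {u} → Desc u u
  there : ∀ {u c v} → c ∈ children u → Desc c v → Desc u v

IsMaxOver : (ATree → ℤ) → ATree → ℤ → Set
IsMaxOver f u m = (∃[ v ] (Desc u v × f v ≡ m)) × (∀ v → Desc u v → f v ≤ m)

-- The invariant of step (2) is: if, before processing a list of children,
-- ā(u) and b̄(u) are the maxima of some sets A and B with ā(u) ≤ b̄(u), then
-- afterwards they are the maxima of A resp. B enlarged by the a- resp.
-- b-values of the processed subtrees.  The reason is that every child is
-- started at b̄(u) + 1, so all of its labels exceed the current ā(u) and b̄(u)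
-- (the new subtree dominates).
module Submission where

open import Defs
open import Data.Integer using (ℤ; +_; _≤_; _⊔_)
open import Data.Integer.Properties
  using (≤-refl; ≤-trans; ≤-antisym; i≤i+j; i≤i⊔j; i≤j⊔i; ⊔-sel; i≤j⇒i⊔j≡j)
open import Data.Product using (_×_; _,_; proj₁; proj₂; ∃-syntax; swap)
open import Data.Sum using (_⊎_; inj₁; inj₂)
open import Data.List using (List; []; _∷_)
open import Data.List.Relation.Unary.Any using (Any)
import Data.List.Relation.Unary.Any as Any
open import Data.List.Relation.Unary.All using (All)
import Data.List.Relation.Unary.All as All
open import Data.List.Membership.Propositional using (find; lose)
open import Level using (0ℓ)
open import Relation.Unary using (Pred; ｛_｝; _∪_; _⊆_; _≐_)
open import Relation.Binary.PropositionalEquality using (_≡_; refl; sym; subst)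

private
  variable
    S S′ A B : Pred ℤ 0ℓ
    m m′ x y : ℤ

record IsMax (S : Pred ℤ 0ℓ) (m : ℤ) : Set where
  field
    attained : S m
    bound    : S ⊆ (_≤ m)
open IsMax

isMax-｛｝ : (x : ℤ) → IsMax ｛ x ｝ x
isMax-｛｝ x = record { attained = refl ; bound = λ { refl → ≤-refl } }

isMax-≐ : S ≐ S′ → IsMax S m → IsMax S′ m
isMax-≐ (S⊆S′ , S′⊆S) p = record
  { attained = S⊆S′ (attained p)
  ; bound    = λ s → bound p (S′⊆S s)
  }

isMax-∪ : IsMax S m → IsMax S′ m′ → IsMax (S ∪ S′) (m ⊔ m′)
isMax-∪ {S = S} {m = m} {S′ = S′} {m′ = m′} p q =
  record { attained = attained-⊔ (⊔-sel m m′) ; bound = bound-⊔ }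
  where
  attained-⊔ : (m ⊔ m′ ≡ m) ⊎ (m ⊔ m′ ≡ m′) → (S ∪ S′) (m ⊔ m′)
  attained-⊔ (inj₁ e) = inj₁ (subst S (sym e) (attained p))
  attained-⊔ (inj₂ e) = inj₂ (subst S′ (sym e) (attained q))
  bound-⊔ : S ∪ S′ ⊆ (_≤ m ⊔ m′)
  bound-⊔ (inj₁ s) = ≤-trans (bound p s) (i≤i⊔j m m′)
  bound-⊔ (inj₂ s) = ≤-trans (bound q s) (i≤j⊔i m m′)

isMax-∪-dominated : m ≤ m′ → IsMax S m → IsMax S′ m′ → IsMax (S ∪ S′) m′
isMax-∪-dominated {S = S} {S′ = S′} m≤m′ p q =
  subst (IsMax (S ∪ S′)) (i≤j⇒i⊔j≡j m≤m′) (isMax-∪ p q)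

isMax-cofinal : (T : Pred ℤ 0ℓ) → T ⊆ S → S ⊆ (λ x → ∃[ y ] T y × x ≤ y) →
                IsMax S m → IsMax T m
isMax-cofinal T T⊆S cofinal p with cofinal (attained p)
... | y , Ty , m≤y = record
  { attained = subst T (≤-antisym (bound p (T⊆S Ty)) m≤y) Ty
  ; bound    = λ t → bound p (T⊆S t)
  }

-- Raising the distinguished element x of {x} ∪ X to some y ≥ x raises the
-- maximum to y ⊔ m; this is step (4), where b(u) ≥ t replaces the start t.
isMax-raise : (X : Pred ℤ 0ℓ) → x ≤ y → IsMax (｛ x ｝ ∪ X) m → IsMax (｛ y ｝ ∪ X) (y ⊔ m)
isMax-raise {x = x} {y = y} X x≤y p =
  isMax-cofinal (｛ y ｝ ∪ X) inclusion cofinal (isMax-∪ (isMax-｛｝ y) p)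
  where
  inclusion : ｛ y ｝ ∪ X ⊆ ｛ y ｝ ∪ (｛ x ｝ ∪ X)
  inclusion (inj₁ e) = inj₁ e
  inclusion (inj₂ s) = inj₂ (inj₂ s)
  cofinal : ｛ y ｝ ∪ (｛ x ｝ ∪ X) ⊆ (λ z → ∃[ w ] (｛ y ｝ ∪ X) w × z ≤ w)
  cofinal (inj₁ refl)        = y , inj₁ refl , ≤-refl
  cofinal (inj₂ (inj₁ refl)) = y , inj₁ refl , x≤y
  cofinal (inj₂ (inj₂ s))    = _ , inj₂ s , ≤-refl

SubVals : (ATree → ℤ) → ATree → Pred ℤ 0ℓ
SubVals f u x = ∃[ v ] Desc u v × f v ≡ x

ForestVals : (ATree → ℤ) → List ATree → Pred ℤ 0ℓ
ForestVals f rs x = Any (λ r → SubVals f r x) rs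

subVals-node : (f : ATree → ℤ) (u : ATree) →
               SubVals f u ≐ ｛ f u ｝ ∪ ForestVals f (children u)
subVals-node f u = split , join
  where
  split : SubVals f u ⊆ ｛ f u ｝ ∪ ForestVals f (children u)
  split (_ , here , e)       = inj₁ e
  split (v , there c∈ d , e) = inj₂ (lose c∈ (v , d , e))
  join : ｛ f u ｝ ∪ ForestVals f (children u) ⊆ SubVals f u
  join (inj₁ e) = u , here , e
  join (inj₂ s) with find s
  ... | _ , c∈ , (v , d , e) = v , there c∈ d , e

forestVals-[] : (f : ATree → ℤ) → A ∪ ForestVals f [] ≐ A
forestVals-[] f = (λ { (inj₁ a) → a ; (inj₂ ()) }) , inj₁

forestVals-∷ : (f : ATree → ℤ) (r : ATree) (rs : List ATree) →
               (A ∪ SubVals f r) ∪ ForestVals f rs ≐ A ∪ ForestVals f (r ∷ rs)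
forestVals-∷ {A = A} f r rs = regroup , ungroup
  where
  regroup : (A ∪ SubVals f r) ∪ ForestVals f rs ⊆ A ∪ ForestVals f (r ∷ rs)
  regroup (inj₁ (inj₁ a)) = inj₁ a
  regroup (inj₁ (inj₂ s)) = inj₂ (Any.here s)
  regroup (inj₂ s)        = inj₂ (Any.there s)
  ungroup : A ∪ ForestVals f (r ∷ rs) ⊆ (A ∪ SubVals f r) ∪ ForestVals f rs
  ungroup (inj₁ a)             = inj₁ (inj₁ a)
  ungroup (inj₂ (Any.here s))  = inj₁ (inj₂ s)
  ungroup (inj₂ (Any.there s)) = inj₂ s

isMaxOver : {f : ATree → ℤ} {u : ATree} → IsMax (SubVals f u) m → IsMaxOver f u m
isMaxOver p = attained p , λ v d → bound p (v , d , refl)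

MaxCorrect : ATree → Set
MaxCorrect u = IsMax (SubVals aOf u) (a̅Of u) × IsMax (SubVals bOf u) (b̅Of u)

Correct : ATree → Set
Correct R = ∀ u → Desc R u → MaxCorrect u

a≤a̅ : {u : ATree} → MaxCorrect u → aOf u ≤ a̅Of u
a≤a̅ {u} c = bound (proj₁ c) (u , here , refl)

correct-node : (u : ATree) → MaxCorrect u → All Correct (children u) → Correct u
correct-node u c _   _ here          = c
correct-node u _ cs  v (there c∈ d) = All.lookup cs c∈ _ d

aOf-assign : ∀ {T t R} → Assign T t R → aOf R ≡ t
aOf-assign (assign _ _ _) = refl

assign-correct : ∀ {T t R} → Assign T t R → Correct R × a̅Of R ≤ b̅Of R
kids-correct : ∀ {cs a̅ b̅ rs a̅′ b̅′} → AssignKids cs a̅ b̅ rs a̅′ b̅′ →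
               IsMax A a̅ → IsMax B b̅ → a̅ ≤ b̅ →
               IsMax (A ∪ ForestVals aOf rs) a̅′ × IsMax (B ∪ ForestVals bOf rs) b̅′ ×
               All Correct rs

assign-correct {t = t} {R = R} (assign {rs = rs} {a̅′} {b̅′} b kids a̅′≤b) =
  correct-node R (maxA , maxB) subtrees , ≤-trans a̅′≤b (i≤i⊔j b b̅′)
  where
  afterKids : IsMax (｛ t ｝ ∪ ForestVals aOf rs) a̅′ × IsMax (｛ t ｝ ∪ ForestVals bOf rs) b̅′ ×
              All Correct rs
  afterKids = kids-correct kids (isMax-｛｝ t) (isMax-｛｝ t) ≤-refl
  maxA : IsMax (SubVals aOf R) a̅′
  maxA = isMax-≐ (swap (subVals-node aOf R)) (proj₁ afterKids)
  t≤b : t ≤ b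
  t≤b = ≤-trans (bound (proj₁ afterKids) (inj₁ refl)) a̅′≤b
  maxB : IsMax (SubVals bOf R) (b ⊔ b̅′)
  maxB = isMax-≐ (swap (subVals-node bOf R))
                 (isMax-raise (ForestVals bOf rs) t≤b (proj₁ (proj₂ afterKids)))
  subtrees : All Correct rs
  subtrees = proj₂ (proj₂ afterKids)

kids-correct kids-nil pA pB _ =
  isMax-≐ (swap (forestVals-[] aOf)) pA , isMax-≐ (swap (forestVals-[] bOf)) pB , All.[]
kids-correct {A = A} {B = B} {b̅ = b̅} {a̅′ = a̅′} {b̅′ = b̅′}
             (kids-cons {r = r} {rs = rs} run kids) pA pB a̅≤b̅ =
  isMax-≐ (forestVals-∷ aOf r rs) (proj₁ rest) ,
  isMax-≐ (forestVals-∷ bOf r rs) (proj₁ (proj₂ rest)) ,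
  correct-r All.∷ proj₂ (proj₂ rest)
  where
  child : Correct r × a̅Of r ≤ b̅Of r
  child = assign-correct run
  correct-r : Correct r
  correct-r = proj₁ child
  -- the child is started at b̅ + 1, so its labels dominate ā and b̄
  b̅≤a̅r : b̅ ≤ a̅Of r
  b̅≤a̅r = ≤-trans (i≤i+j b̅ (+ 1))
                  (subst (_≤ a̅Of r) (aOf-assign run) (a≤a̅ (correct-r r here)))
  rest : IsMax ((A ∪ SubVals aOf r) ∪ ForestVals aOf rs) a̅′ ×
         IsMax ((B ∪ SubVals bOf r) ∪ ForestVals bOf rs) b̅′ × All Correct rs
  rest = kids-correct kids
           (isMax-∪-dominated (≤-trans a̅≤b̅ b̅≤a̅r) pA (proj₁ (correct-r r here)))
           (isMax-∪-dominated (≤-trans b̅≤a̅r (proj₂ child)) pB (proj₂ (correct-r r here)))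
           (proj₂ child)

lemma3 : (T : Tree) (R : ATree) → Assign T (+ 0) R →
    ∀ u → Desc R u → IsMaxOver aOf u (a̅Of u) × IsMaxOver bOf u (b̅Of u)
lemma3 T R run u d with proj₁ (assign-correct run) u d
... | maxA , maxB = isMaxOver maxA , isMaxOver maxB
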